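{- Let $\mathcal V$ be a finitely generated variety of SMB algebras, let $\mathbf A\in\mathcal V$ be an SMB algebra over the congruence ${\sim}$, and let $a,b,c,e\in A$. Then $\mathrm{Cg}^{\mathbf A}(a,b)\cap\mathrm{Cg}^{\mathbf A}(c,e)\subseteq{\sim}$ if and only if $\mathrm{Cg}^{\mathbf A/{\sim}}([a]_{\sim},[b]_{\sim})\cap\mathrm{Cg}^{\mathbf A/{\sim}}([c]_{\sim},[e]_{\sim})=0_{\mathbf A/{\sim}}$.
   Context: An algebra $\mathbf A=(A;\wedge,d)$ is idempotent if $x\wedge x=x$ and $d(x,x,x)=x$ for all $x$. For a congruence ${\sim}$ of $\mathbf A$, $\mathbf A$ is an SMB algebra over ${\sim}$ if it is idempotent, $(A/{\sim};\wedge)$ is a semilattice, and on each ${\sim}$-class $\wedge$ acts as the second projection and $d$ acts as a Mal'cev operation ($d(x,y,y)=x=d(y,y,x)$); an SMB algebra is one that is SMB over some congruence. A variety of SMB algebras is a variety in the language $\{\wedge,d\}$ all of whose members are SMB algebras; it is finitely generated if it is generated by a single finite algebra. Members of $\mathcal V$ may be infinite. -}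

module Defs where

open import Data.Nat using (ℕ)
open import Data.Fin using (Fin)
open import Data.Product using (Σ; _×_)
open import Relation.Binary.PropositionalEquality using (_≡_)

-- Algebras in the language {∧, d} (∧ binary, d ternary).
-- Carriers are setoids (Agda has no quotient types); the quotient A/θ
-- is then the same carrier with equality replaced by θ.

record Algebra : Set₁ where
  infixr 7 _∧_
  infix 4 _≈_
  field
    Carrier : Set
    _≈_     : Carrier → Carrier → Set
    ≈-refl  : ∀ {x} → x ≈ x
    ≈-sym   : ∀ {x y} → x ≈ y → y ≈ x
    ≈-trans : ∀ {x y z} → x ≈ y → y ≈ z → x ≈ z
    _∧_     : Carrier → Carrier → Carrier
    d       : Carrier → Carrier → Carrier → Carrier
    ∧-cong  : ∀ {x x' y y'} → x ≈ x' → y ≈ y' → (x ∧ y) ≈ (x' ∧ y')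
    d-cong  : ∀ {x x' y y' z z'} → x ≈ x' → y ≈ y' → z ≈ z' →
              d x y z ≈ d x' y' z'

open Algebra public

BinRel : Algebra → Set₁
BinRel A = Carrier A → Carrier A → Set

_⊆ᵣ_ : {A : Algebra} → BinRel A → BinRel A → Set
_⊆ᵣ_ {A} R S = ∀ (x y : Carrier A) → R x y → S x y

_≐ᵣ_ : {A : Algebra} → BinRel A → BinRel A → Set
_≐ᵣ_ {A} R S = _⊆ᵣ_ {A} R S × _⊆ᵣ_ {A} S R

_∩ᵣ_ : {A : Algebra} → BinRel A → BinRel A → BinRel A
(R ∩ᵣ S) x y = R x y × S x y

record Congruence (A : Algebra) : Set₁ where
  field
    rel      : Carrier A → Carrier A → Set
    ≈⊆rel    : ∀ {x y} → _≈_ A x y → rel x y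
    rel-sym   : ∀ {x y} → rel x y → rel y x
    rel-trans : ∀ {x y z} → rel x y → rel y z → rel x z
    rel-∧    : ∀ {x x' y y'} → rel x x' → rel y y' →
               rel (_∧_ A x y) (_∧_ A x' y')
    rel-d    : ∀ {x x' y y' z z'} → rel x x' → rel y y' → rel z z' →
               rel (d A x y z) (d A x' y' z')

open Congruence public

0ᶜ : (A : Algebra) → BinRel A
0ᶜ A = _≈_ A

data Cg (A : Algebra) (a b : Carrier A) : Carrier A → Carrier A → Set where
  cg-≈     : ∀ {x y} → _≈_ A x y → Cg A a b x y
  cg-gen   : Cg A a b a b
  cg-sym   : ∀ {x y} → Cg A a b x y → Cg A a b y x
  cg-trans : ∀ {x y z} → Cg A a b x y → Cg A a b y z → Cg A a b x z
  cg-∧     : ∀ {x x' y y'} → Cg A a b x x' → Cg A a b y y' →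
             Cg A a b (_∧_ A x y) (_∧_ A x' y')
  cg-d     : ∀ {x x' y y' z z'} → Cg A a b x x' → Cg A a b y y' →
             Cg A a b z z' → Cg A a b (d A x y z) (d A x' y' z')

-- Quotient algebra A/θ : same carrier, equality θ.  The class [x]_θ is
-- represented by x itself.
_/_ : (A : Algebra) → Congruence A → Algebra
A / θ = record
  { Carrier = Carrier A
  ; _≈_     = rel θ
  ; ≈-refl  = ≈⊆rel θ (≈-refl A)
  ; ≈-sym   = rel-sym θ
  ; ≈-trans = rel-trans θ
  ; _∧_     = _∧_ A
  ; d       = d A
  ; ∧-cong  = rel-∧ θ
  ; d-cong  = rel-d θ
  }

record IsSMBOver (A : Algebra) (θ : Congruence A) : Set where
  private
    _⊓_ = _∧_ A
    _≋_ = _≈_ A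
    δ = d A
  field
    idem-∧ : ∀ x → (x ⊓ x) ≋ x
    idem-d : ∀ x → δ x x x ≋ x
    sl-assoc : ∀ x y z → rel θ ((x ⊓ y) ⊓ z) (x ⊓ (y ⊓ z))
    sl-comm  : ∀ x y → rel θ (x ⊓ y) (y ⊓ x)
    sl-idem  : ∀ x → rel θ (x ⊓ x) x
    class-∧    : ∀ x y → rel θ x y → (x ⊓ y) ≋ y
    class-d-l  : ∀ x y → rel θ x y → δ x y y ≋ x
    class-d-r  : ∀ x y → rel θ x y → δ y y x ≋ x

IsSMB : Algebra → Set₁
IsSMB A = Σ (Congruence A) (IsSMBOver A)

data Term : Set where
  var  : ℕ → Term
  _∧ₜ_ : Term → Term → Term
  dₜ   : Term → Term → Term → Term

⟦_⟧ : {A : Algebra} → Term → (ℕ → Carrier A) → Carrier A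
⟦_⟧ {A} (var i) ρ = ρ i
⟦_⟧ {A} (s ∧ₜ t) ρ = _∧_ A (⟦_⟧ {A} s ρ) (⟦_⟧ {A} t ρ)
⟦_⟧ {A} (dₜ s t u) ρ = d A (⟦_⟧ {A} s ρ) (⟦_⟧ {A} t ρ) (⟦_⟧ {A} u ρ)

_⊨_≈ₜ_ : Algebra → Term → Term → Set
A ⊨ s ≈ₜ t = ∀ (ρ : ℕ → Carrier A) → _≈_ A (⟦_⟧ {A} s ρ) (⟦_⟧ {A} t ρ)

finAlg : (n : ℕ) → (Fin n → Fin n → Fin n) → (Fin n → Fin n → Fin n → Fin n) →
         Algebra
finAlg n m t = record
  { Carrier = Fin n
  ; _≈_ = _≡_
  ; ≈-refl = Relation.Binary.PropositionalEquality.refl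
  ; ≈-sym = Relation.Binary.PropositionalEquality.sym
  ; ≈-trans = Relation.Binary.PropositionalEquality.trans
  ; _∧_ = m
  ; d = t
  ; ∧-cong = Relation.Binary.PropositionalEquality.cong₂ m
  ; d-cong = λ p q r → cong₃ p q r
  }
  where
  open import Relation.Binary.PropositionalEquality
  cong₃ : ∀ {x x' y y' z z'} → x ≡ x' → y ≡ y' → z ≡ z' → t x y z ≡ t x' y' z'
  cong₃ refl refl refl = refl

-- Membership in the variety V(F) generated by F (Birkhoff: V(F) is the
-- class of all algebras satisfying every identity that holds in F).
_∈V_ : Algebra → Algebra → Set
B ∈V F = ∀ (s t : Term) → F ⊨ s ≈ₜ t → B ⊨ s ≈ₜ t

IsSMBVariety : Algebra → Set₁
IsSMBVariety F = ∀ (B : Algebra) → B ∈V F → IsSMB B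

{-# OPTIONS --safe #-}
-- For a congruence α of A put  x Φ_α y  iff  x α (y ∧ x)  and  y α (x ∧ y).
-- Because ∧ is a semilattice operation modulo ∼ and a right projection on
-- ∼-classes, Φ_α is a congruence of A/∼; it contains (a, b) when α = Cg(a, b),
-- so Cg^{A/∼}(a, b) ⊆ Φ_{Cg(a,b)}. Hence if x, y are related by both quotient
-- congruences, then x ∼ (y ∧ x) ∼ (x ∧ y) ∼ y as soon as Cg(a,b) ∩ Cg(c,e) ⊆ ∼.
-- The converse holds since Cg^A(a, b) ⊆ Cg^{A/∼}(a, b).
module Submission where

open import Defs
open import Data.Nat using (ℕ)
open import Data.Fin using (Fin)
open import Function.Bundles using (_⇔_; mk⇔)
open import Data.Product using (_,_; _×_)

Cgᶜ : (B : Algebra) (a b : Carrier B) → Congruence B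
Cgᶜ B a b = record
  { rel = Cg B a b ; ≈⊆rel = cg-≈ ; rel-sym = cg-sym ; rel-trans = cg-trans
  ; rel-∧ = cg-∧ ; rel-d = cg-d }

Cg-least : {B : Algebra} (θ : Congruence B) {a b : Carrier B} →
           rel θ a b → _⊆ᵣ_ {B} (Cg B a b) (rel θ)
Cg-least θ θab _ _ = go
  where
  go : ∀ {x y} → Cg _ _ _ x y → rel θ x y
  go (cg-≈ x≈y)     = ≈⊆rel θ x≈y
  go cg-gen         = θab
  go (cg-sym p)     = rel-sym θ (go p)
  go (cg-trans p q) = rel-trans θ (go p) (go q)
  go (cg-∧ p q)     = rel-∧ θ (go p) (go q)
  go (cg-d p q r)   = rel-d θ (go p) (go q) (go r)

liftCongruence : {A : Algebra} (S : Congruence A) → Congruence (A / S) → Congruence A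
liftCongruence S θ = record
  { rel = rel θ ; ≈⊆rel = λ x≈y → ≈⊆rel θ (≈⊆rel S x≈y) ; rel-sym = rel-sym θ
  ; rel-trans = rel-trans θ ; rel-∧ = rel-∧ θ ; rel-d = rel-d θ }

Cg⊆Cg-quotient : {A : Algebra} (S : Congruence A) (a b : Carrier A) →
                 _⊆ᵣ_ {A} (Cg A a b) (Cg (A / S) a b)
Cg⊆Cg-quotient S a b = Cg-least (liftCongruence S (Cgᶜ (_ / S) a b)) cg-gen

module SMB {A : Algebra} {∼ : Congruence A} (smb : IsSMBOver A ∼) where
  open IsSMBOver smb
  private
    _⊓_ = _∧_ A
    infixr 7 _⊓_

  ∧-comm-∼ : ∀ {x x' y y'} → rel ∼ x x' → rel ∼ y y' → rel ∼ (x ⊓ y) (y' ⊓ x')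
  ∧-comm-∼ {x' = x'} {y' = y'} p q = rel-trans ∼ (rel-∧ ∼ p q) (sl-comm x' y')

  module _ (α : Congruence A) where
    private
      α-refl : ∀ {x} → rel α x x
      α-refl = ≈⊆rel α (≈-refl A)

    -- From x α q, t α q' and q ∼ q':  t ∧ x  α  t ∧ q  α  q' ∧ q  ≈  q  α  x.
    absorb : ∀ {x q t q'} → rel α x q → rel α t q' → rel ∼ q q' → rel α x (t ⊓ x)
    absorb {q = q} {t} {q'} xq tq' qq' =
      rel-trans α xq (rel-sym α (rel-trans α (rel-∧ α α-refl xq) t⊓q-α-q))
      where
      t⊓q-α-q : rel α (t ⊓ q) q
      t⊓q-α-q = rel-trans α (rel-∧ α tq' α-refl)
                (≈⊆rel α (class-∧ q' q (rel-sym ∼ qq')))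

    MeetLinked : Carrier A → Carrier A → Set
    MeetLinked x y = rel α x (y ⊓ x) × rel α y (x ⊓ y)

    ⊆MeetLinked : ∀ {x y} → rel α x y → MeetLinked x y
    ⊆MeetLinked xy = linked xy , linked (rel-sym α xy)
      where
      linked : ∀ {u v} → rel α u v → rel α u (v ⊓ u)
      linked {u} uv = rel-trans α (≈⊆rel α (≈-sym A (idem-∧ u))) (rel-∧ α uv α-refl)

    private
      flip : ∀ {x y} → MeetLinked x y → MeetLinked y x
      flip (p , q) = q , p

      trans-first : ∀ {x y z} → MeetLinked x y → MeetLinked y z → rel α x (z ⊓ x)
      trans-first {x} {y} {z} (xy , yx) (yz , zy) =
        absorb (rel-trans α xy (rel-∧ α yz α-refl))
               (rel-trans α zy (rel-∧ α yx α-refl))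
               (rel-trans ∼ (sl-assoc z y x) (∧-comm-∼ (≈⊆rel ∼ (≈-refl A)) (sl-comm y x)))

      ∧-first : ∀ {x x' y y'} → MeetLinked x x' → MeetLinked y y' →
           rel α (x ⊓ y) ((x' ⊓ y') ⊓ (x ⊓ y))
      ∧-first (p , p') (q , q') =
        absorb (rel-∧ α p q) (rel-∧ α p' q') (rel-∧ ∼ (sl-comm _ _) (sl-comm _ _))

      d-first : ∀ {x x' y y' z z'} → MeetLinked x x' → MeetLinked y y' → MeetLinked z z' →
           rel α (d A x y z) (d A x' y' z' ⊓ d A x y z)
      d-first (p , p') (q , q') (r , r') =
        absorb (rel-d α p q r) (rel-d α p' q' r')
               (rel-d ∼ (sl-comm _ _) (sl-comm _ _) (sl-comm _ _))

    meetLinked : Congruence (A / ∼)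
    meetLinked = record
      { rel = MeetLinked
      ; ≈⊆rel = λ {x} {y} x∼y →
          ≈⊆rel α (≈-sym A (class-∧ y x (rel-sym ∼ x∼y))) ,
          ≈⊆rel α (≈-sym A (class-∧ x y x∼y))
      ; rel-sym = flip
      ; rel-trans = λ p q → trans-first p q , trans-first (flip q) (flip p)
      ; rel-∧ = λ p q → ∧-first p q , ∧-first (flip p) (flip q)
      ; rel-d = λ p q r → d-first p q r , d-first (flip p) (flip q) (flip r)
      }

  Cg-quotient⊆meetLinked : (a b : Carrier A) →
    _⊆ᵣ_ {A / ∼} (Cg (A / ∼) a b) (rel (meetLinked (Cgᶜ A a b)))
  Cg-quotient⊆meetLinked a b = Cg-least (meetLinked (Cgᶜ A a b)) (⊆MeetLinked (Cgᶜ A a b) cg-gen)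

  MeetLinked-∩⊆ : (α β : Congruence A) → _⊆ᵣ_ {A} (_∩ᵣ_ {A} (rel α) (rel β)) (rel ∼) →
                  _⊆ᵣ_ {A} (_∩ᵣ_ {A} (MeetLinked α) (MeetLinked β)) (rel ∼)
  MeetLinked-∩⊆ α β α∩β⊆∼ x y ((xα , yα) , (xβ , yβ)) =
    rel-trans ∼ (α∩β⊆∼ x (y ⊓ x) (xα , xβ))
      (rel-trans ∼ (sl-comm y x) (rel-sym ∼ (α∩β⊆∼ y (x ⊓ y) (yα , yβ))))

corollary7p4 : (n : ℕ) (m : Fin n → Fin n → Fin n) (t : Fin n → Fin n → Fin n → Fin n) →
    IsSMBVariety (finAlg n m t) →
    (A : Algebra) → A ∈V finAlg n m t →
    (∼ : Congruence A) → IsSMBOver A ∼ →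
    (a b c e : Carrier A) →
    (_⊆ᵣ_ {A} (_∩ᵣ_ {A} (Cg A a b) (Cg A c e)) (rel ∼)
    ⇔
    _≐ᵣ_ {A / ∼} (_∩ᵣ_ {A / ∼} (Cg (A / ∼) a b) (Cg (A / ∼) c e)) (0ᶜ (A / ∼)))
corollary7p4 _ _ _ _ A _ ∼ smb a b c e = mk⇔ trivial-in-quotient from-quotient
  where
  open SMB smb

  trivial-in-quotient : _⊆ᵣ_ {A} (_∩ᵣ_ {A} (Cg A a b) (Cg A c e)) (rel ∼) →
    _≐ᵣ_ {A / ∼} (_∩ᵣ_ {A / ∼} (Cg (A / ∼) a b) (Cg (A / ∼) c e)) (0ᶜ (A / ∼))
  trivial-in-quotient H =
    (λ x y (xy , xy') → MeetLinked-∩⊆ (Cgᶜ A a b) (Cgᶜ A c e) H x y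
        (Cg-quotient⊆meetLinked a b x y xy , Cg-quotient⊆meetLinked c e x y xy')) ,
    (λ x y x∼y → cg-≈ x∼y , cg-≈ x∼y)

  from-quotient : _≐ᵣ_ {A / ∼} (_∩ᵣ_ {A / ∼} (Cg (A / ∼) a b) (Cg (A / ∼) c e)) (0ᶜ (A / ∼)) →
    _⊆ᵣ_ {A} (_∩ᵣ_ {A} (Cg A a b) (Cg A c e)) (rel ∼)
  from-quotient (H , _) x y (xy , xy') =
    H x y (Cg⊆Cg-quotient ∼ a b x y xy , Cg⊆Cg-quotient ∼ c e x y xy')
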